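{- Let $\mathcal{B}$ be a category with finite limits, let $\mathcal{M}$ be a class of monomorphisms in $\mathcal{B}$, and let $G$ be a group object in $\mathcal{B}$ with multiplication written $\cdot$. Let $p:[\mathbf{B}G]\to\mathcal{B}$ be the externalization of the one-object internal groupoid $\mathbf{B}G$: its objects are the objects of $\mathcal{B}$, a morphism $I\to J$ is a pair $(f,u)$ of a morphism $f:I\to J$ of $\mathcal{B}$ and a generalized element $u:I\to G$, composition is $(g,v)\circ(f,u)=(g\circ f,(v\circ f)\cdot u)$, and $p(f,u)=f$ (every morphism is cartesian). Let $T=1_{\mathcal{B}}$ be the terminal object. Then $T$ is an $\mathcal{M}$-acyclic generic object for $p$ if and only if $G$ has the right lifting property with respect to every element of $\mathcal{M}$, i.e. for every $m:J\rightarrowtail I$ in $\mathcal{M}$ and every $g:J\to G$ there exists $\hat g:I\to G$ with $\hat g\circ m=g$.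
   Context: For a fibration $p:\mathcal{E}\to\mathcal{B}$, a generic object is an object $T$ such that every $X\in\mathcal{E}$ admits a cartesian morphism $X\to T$. A generic object $T$ is $\mathcal{M}$-acyclic if for every span $X\leftarrow U\to T$ of cartesian morphisms in $\mathcal{E}$ such that the image $pU\to pX$ of $U\to X$ lies in $\mathcal{M}$, there exists a cartesian morphism $X\to T$ such that the composite $U\to X\to T$ equals the given $U\to T$. (A morphism $f:E\to F$ is cartesian if for every $g:H\to F$ and $v:pH\to pE$ with $pf\circ v=pg$ there is a unique $h$ over $v$ with $f\circ h=g$.) -}

module Defs where

open import Level using (Level; _⊔_) renaming (suc to lsuc)
open import Relation.Binary using (Rel; IsEquivalence; Setoid)
open import Data.Product using (Σ; _×_; _,_; proj₁; proj₂)
import Relation.Binary.Reasoning.Setoid as SetoidR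

record Category (o ℓ e : Level) : Set (lsuc (o ⊔ ℓ ⊔ e)) where
  infixr 9 _∘_
  infix  4 _≈_
  infixr 5 _⇒_
  field
    Obj : Set o
    _⇒_ : Obj → Obj → Set ℓ
    _≈_ : ∀ {A B} → Rel (A ⇒ B) e
    id  : ∀ {A} → A ⇒ A
    _∘_ : ∀ {A B C} → B ⇒ C → A ⇒ B → A ⇒ C
    equiv     : ∀ {A B} → IsEquivalence (_≈_ {A} {B})
    assoc     : ∀ {A B C D} {f : A ⇒ B} {g : B ⇒ C} {h : C ⇒ D} →
                (h ∘ g) ∘ f ≈ h ∘ (g ∘ f)
    identityˡ : ∀ {A B} {f : A ⇒ B} → id ∘ f ≈ f
    identityʳ : ∀ {A B} {f : A ⇒ B} → f ∘ id ≈ f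
    ∘-resp-≈  : ∀ {A B C} {f h : B ⇒ C} {g i : A ⇒ B} →
                f ≈ h → g ≈ i → f ∘ g ≈ h ∘ i

  hom-setoid : ∀ {A B} → Setoid ℓ e
  hom-setoid {A} {B} = record { Carrier = A ⇒ B ; _≈_ = _≈_ ; isEquivalence = equiv }

  module _ {A B : Obj} where
    open IsEquivalence (equiv {A} {B}) public
      using () renaming (refl to ≈-refl; sym to ≈-sym; trans to ≈-trans)

  Mono : ∀ {A B} → A ⇒ B → Set (o ⊔ ℓ ⊔ e)
  Mono {A} f = ∀ {X} (g h : X ⇒ A) → f ∘ g ≈ f ∘ h → g ≈ h

record Functor {o ℓ e o′ ℓ′ e′} (C : Category o ℓ e) (D : Category o′ ℓ′ e′)
       : Set (o ⊔ ℓ ⊔ e ⊔ o′ ⊔ ℓ′ ⊔ e′) where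
  private
    module C = Category C
    module D = Category D
  field
    F₀ : C.Obj → D.Obj
    F₁ : ∀ {A B} → A C.⇒ B → F₀ A D.⇒ F₀ B
    identity     : ∀ {A} → F₁ (C.id {A}) D.≈ D.id
    homomorphism : ∀ {X Y Z} {f : X C.⇒ Y} {g : Y C.⇒ Z} →
                   F₁ (g C.∘ f) D.≈ F₁ g D.∘ F₁ f
    F-resp-≈     : ∀ {A B} {f g : A C.⇒ B} → f C.≈ g → F₁ f D.≈ F₁ g

module _ {o ℓ e} (C : Category o ℓ e) where
  open Category C

  record Terminal : Set (o ⊔ ℓ ⊔ e) where
    field
      ⊤ : Obj
      ! : ∀ {A} → A ⇒ ⊤
      !-unique : ∀ {A} (f : A ⇒ ⊤) → ! ≈ f

  record Product (A B : Obj) : Set (o ⊔ ℓ ⊔ e) where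
    field
      A×B : Obj
      π₁ : A×B ⇒ A
      π₂ : A×B ⇒ B
      ⟨_,_⟩ : ∀ {X} → X ⇒ A → X ⇒ B → X ⇒ A×B
      project₁ : ∀ {X} {f : X ⇒ A} {g : X ⇒ B} → π₁ ∘ ⟨ f , g ⟩ ≈ f
      project₂ : ∀ {X} {f : X ⇒ A} {g : X ⇒ B} → π₂ ∘ ⟨ f , g ⟩ ≈ g
      unique   : ∀ {X} {h : X ⇒ A×B} {f : X ⇒ A} {g : X ⇒ B} →
                 π₁ ∘ h ≈ f → π₂ ∘ h ≈ g → ⟨ f , g ⟩ ≈ h

  record Equalizer {A B : Obj} (f g : A ⇒ B) : Set (o ⊔ ℓ ⊔ e) where
    field
      obj : Obj
      arr : obj ⇒ A
      equality : f ∘ arr ≈ g ∘ arr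
      equalize : ∀ {X} {h : X ⇒ A} → f ∘ h ≈ g ∘ h → X ⇒ obj
      universal : ∀ {X} {h : X ⇒ A} {eq : f ∘ h ≈ g ∘ h} → arr ∘ equalize eq ≈ h
      unique : ∀ {X} {h : X ⇒ A} {i : X ⇒ obj} (eq : f ∘ h ≈ g ∘ h) →
               arr ∘ i ≈ h → equalize eq ≈ i

  record FiniteLimits : Set (o ⊔ ℓ ⊔ e) where
    field
      terminal  : Terminal
      product   : ∀ A B → Product A B
      equalizer : ∀ {A B} (f g : A ⇒ B) → Equalizer f g

  record MonoClass (r : Level) : Set (o ⊔ ℓ ⊔ e ⊔ lsuc r) where
    field
      member : ∀ {J I} → J ⇒ I → Set r
      mono   : ∀ {J I} {m : J ⇒ I} → member m → Mono m

-- Group objects (axioms stated on generalized elements I ⇒ G, where the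
-- product of u,v : I ⇒ G is μ ∘ ⟨ u , v ⟩ and the unit is η ∘ !)

module _ {o ℓ e} (C : Category o ℓ e) (L : FiniteLimits C) where
  open Category C
  open FiniteLimits L
  open Terminal terminal

  record GroupObject : Set (o ⊔ ℓ ⊔ e) where
    field
      G : Obj
    open Product (product G G)
    field
      μ : A×B ⇒ G
      η : ⊤ ⇒ G
      ι : G ⇒ G
      ·-assoc : ∀ {I} (u v w : I ⇒ G) →
                μ ∘ ⟨ μ ∘ ⟨ u , v ⟩ , w ⟩ ≈ μ ∘ ⟨ u , μ ∘ ⟨ v , w ⟩ ⟩
      ·-unitˡ : ∀ {I} (u : I ⇒ G) → μ ∘ ⟨ η ∘ ! , u ⟩ ≈ u
      ·-unitʳ : ∀ {I} (u : I ⇒ G) → μ ∘ ⟨ u , η ∘ ! ⟩ ≈ u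
      ·-invˡ  : ∀ {I} (u : I ⇒ G) → μ ∘ ⟨ ι ∘ u , u ⟩ ≈ η ∘ !
      ·-invʳ  : ∀ {I} (u : I ⇒ G) → μ ∘ ⟨ u , ι ∘ u ⟩ ≈ η ∘ !

  HasRLP : ∀ {r} → MonoClass C r → Obj → Set (o ⊔ ℓ ⊔ e ⊔ r)
  HasRLP M G = ∀ {J I} (m : J ⇒ I) → MonoClass.member M m → (g : J ⇒ G) →
               Σ (I ⇒ G) λ ĝ → ĝ ∘ m ≈ g

module Externalization {o ℓ e} (C : Category o ℓ e) (L : FiniteLimits C)
                       (Gp : GroupObject C L) where
  open Category C
  open FiniteLimits L
  open Terminal terminal
  open GroupObject Gp
  open Product (product G G)

  infixl 7 _·_
  _·_ : ∀ {I} → I ⇒ G → I ⇒ G → I ⇒ G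
  u · v = μ ∘ ⟨ u , v ⟩

  ε : ∀ {I} → I ⇒ G
  ε = η ∘ !

  private
    ⟨⟩-resp : ∀ {X} {f f′ : X ⇒ G} {g g′ : X ⇒ G} → f ≈ f′ → g ≈ g′ →
              ⟨ f , g ⟩ ≈ ⟨ f′ , g′ ⟩
    ⟨⟩-resp p q = unique (≈-trans project₁ (≈-sym p)) (≈-trans project₂ (≈-sym q))

    ⟨⟩∘ : ∀ {X Y} {f g : Y ⇒ G} {h : X ⇒ Y} → ⟨ f , g ⟩ ∘ h ≈ ⟨ f ∘ h , g ∘ h ⟩
    ⟨⟩∘ {f = f} {g} {h} = ≈-sym (unique
      (≈-trans (≈-sym assoc) (∘-resp-≈ project₁ ≈-refl))
      (≈-trans (≈-sym assoc) (∘-resp-≈ project₂ ≈-refl)))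

  ·-resp : ∀ {I} {u u′ v v′ : I ⇒ G} → u ≈ u′ → v ≈ v′ → u · v ≈ u′ · v′
  ·-resp p q = ∘-resp-≈ ≈-refl (⟨⟩-resp p q)

  ·-∘ : ∀ {I J} {u v : J ⇒ G} {f : I ⇒ J} → (u · v) ∘ f ≈ (u ∘ f) · (v ∘ f)
  ·-∘ = ≈-trans assoc (∘-resp-≈ ≈-refl ⟨⟩∘)

  ε-∘ : ∀ {I J} {f : I ⇒ J} → ε ∘ f ≈ ε
  ε-∘ = ≈-trans assoc (∘-resp-≈ ≈-refl (≈-sym (!-unique _)))

  BG : Category o ℓ e
  BG = record
    { Obj = Obj
    ; _⇒_ = λ I J → (I ⇒ J) × (I ⇒ G)
    ; _≈_ = λ a b → (proj₁ a ≈ proj₁ b) × (proj₂ a ≈ proj₂ b)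
    ; id  = id , ε
    ; _∘_ = λ { (g , v) (f , u) → (g ∘ f) , ((v ∘ f) · u) }
    ; equiv = record
        { refl  = ≈-refl , ≈-refl
        ; sym   = λ { (p , q) → ≈-sym p , ≈-sym q }
        ; trans = λ { (p , q) (p′ , q′) → ≈-trans p p′ , ≈-trans q q′ }
        }
    ; assoc = λ { {f = f , u} {g , v} {h , w} →
        assoc ,
        ≈-trans (·-resp (≈-trans ·-∘ (·-resp assoc ≈-refl)) ≈-refl)
                (GroupObject.·-assoc Gp _ _ _) }
    ; identityˡ = identityˡ , ≈-trans (·-resp ε-∘ ≈-refl) (·-unitˡ _)
    ; identityʳ = identityʳ , ≈-trans (·-resp identityʳ ≈-refl) (·-unitʳ _)
    ; ∘-resp-≈ = λ { (p , q) (p′ , q′) →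
        ∘-resp-≈ p p′ , ·-resp (∘-resp-≈ q p′) q′ }
    }

  p : Functor BG C
  p = record
    { F₀ = λ I → I
    ; F₁ = proj₁
    ; identity = ≈-refl
    ; homomorphism = ≈-refl
    ; F-resp-≈ = proj₁
    }

module _ {o ℓ e o′ ℓ′ e′} {E : Category o ℓ e} {B : Category o′ ℓ′ e′}
         (P : Functor E B) where
  private
    module E = Category E
    module B = Category B
  open Functor P

  IsCartesian : ∀ {X Y} → X E.⇒ Y → Set (o ⊔ ℓ ⊔ e ⊔ ℓ′ ⊔ e′)
  IsCartesian {X} {Y} f =
    ∀ {H} (g : H E.⇒ Y) (v : F₀ H B.⇒ F₀ X) → F₁ f B.∘ v B.≈ F₁ g →
    Σ (H E.⇒ X) λ h → (F₁ h B.≈ v) × (f E.∘ h E.≈ g) ×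
      (∀ (h′ : H E.⇒ X) → F₁ h′ B.≈ v → f E.∘ h′ E.≈ g → h E.≈ h′)

  IsGeneric : E.Obj → Set (o ⊔ ℓ ⊔ e ⊔ ℓ′ ⊔ e′)
  IsGeneric T = ∀ (X : E.Obj) → Σ (X E.⇒ T) IsCartesian

  IsAcyclic : ∀ {r} → (∀ {J I} → J B.⇒ I → Set r) → E.Obj →
              Set (o ⊔ ℓ ⊔ e ⊔ ℓ′ ⊔ e′ ⊔ r)
  IsAcyclic M T =
    ∀ {X U} (c : U E.⇒ X) (t : U E.⇒ T) → IsCartesian c → IsCartesian t →
    M (F₁ c) → Σ (X E.⇒ T) λ x → IsCartesian x × (x E.∘ c E.≈ t)

  IsAcyclicGeneric : ∀ {r} → (∀ {J I} → J B.⇒ I → Set r) → E.Obj →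
                     Set (o ⊔ ℓ ⊔ e ⊔ ℓ′ ⊔ e′ ⊔ r)
  IsAcyclicGeneric M T = IsGeneric T × IsAcyclic M T

terminalObj : ∀ {o ℓ e} {C : Category o ℓ e} → FiniteLimits C → Category.Obj C
terminalObj L = Terminal.⊤ (FiniteLimits.terminal L)

{-# OPTIONS --safe #-}
module Submission where

-- Division by the G-component makes every morphism of [BG] cartesian, and every
-- object admits (!, ε) into the terminal object, so acyclicity is all that is at
-- stake. For a span (m , u) : U → X and (! , t) : U → 1, a morphism (! , ĝ) : X → 1
-- closes the triangle exactly when (ĝ ∘ m) · u ≈ t, i.e. when ĝ extends t · u⁻¹
-- along m; conversely the span (m , ε), (! , g) turns acyclicity into a lift of g.

open import Level using (_⊔_)
open import Data.Product using (Σ; _,_; proj₁)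
open import Function.Bundles using (_⇔_; mk⇔)
open import Defs
import Relation.Binary.Reasoning.Setoid as SetoidReasoning

module GroupObjectProperties {o ℓ e} {B : Category o ℓ e} {L : FiniteLimits B}
                             (Gp : GroupObject B L) where
  open Category B
  open GroupObject Gp
  open Externalization B L Gp

  infix 8 _⁻¹
  _⁻¹ : ∀ {I} → I ⇒ G → I ⇒ G
  u ⁻¹ = ι ∘ u

  module _ {I : Obj} where
    open SetoidReasoning (hom-setoid {I} {G})

    ·-inverseʳ-cancelˡ : (u w : I ⇒ G) → u · (u ⁻¹ · w) ≈ w
    ·-inverseʳ-cancelˡ u w = begin
      u · (u ⁻¹ · w)  ≈⟨ ·-assoc u (u ⁻¹) w ⟨
      (u · u ⁻¹) · w  ≈⟨ ·-resp (·-invʳ u) ≈-refl ⟩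
      ε · w           ≈⟨ ·-unitˡ w ⟩
      w               ∎

    ·-inverseˡ-cancelˡ : (u w : I ⇒ G) → u ⁻¹ · (u · w) ≈ w
    ·-inverseˡ-cancelˡ u w = begin
      u ⁻¹ · (u · w)  ≈⟨ ·-assoc (u ⁻¹) u w ⟨
      (u ⁻¹ · u) · w  ≈⟨ ·-resp (·-invˡ u) ≈-refl ⟩
      ε · w           ≈⟨ ·-unitˡ w ⟩
      w               ∎

    ·-inverseˡ-cancelʳ : (w u : I ⇒ G) → (w · u ⁻¹) · u ≈ w
    ·-inverseˡ-cancelʳ w u = begin
      (w · u ⁻¹) · u  ≈⟨ ·-assoc w (u ⁻¹) u ⟩
      w · (u ⁻¹ · u)  ≈⟨ ·-resp ≈-refl (·-invˡ u) ⟩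
      w · ε           ≈⟨ ·-unitʳ w ⟩
      w               ∎

module ExternalizationProperties {o ℓ e} (B : Category o ℓ e) (L : FiniteLimits B)
                                 (Gp : GroupObject B L) where
  open Category B
  open FiniteLimits L
  open Terminal terminal
  open GroupObject Gp
  open Externalization B L Gp
  open GroupObjectProperties Gp

  private
    module BG = Category BG

  RightLifts : ∀ {r} → (∀ {J I} → J ⇒ I → Set r) → Obj → Set (o ⊔ ℓ ⊔ e ⊔ r)
  RightLifts M X = ∀ {J I} (m : J ⇒ I) → M m → (g : J ⇒ X) →
                   Σ (I ⇒ X) λ ĝ → ĝ ∘ m ≈ g

  isCartesian : ∀ {X Y} (f : X BG.⇒ Y) → IsCartesian p f
  isCartesian {X} (f , u) {H} (g , w) v fv≈g =
    (v , (u ∘ v) ⁻¹ · w) , ≈-refl , (fv≈g , ·-inverseʳ-cancelˡ (u ∘ v) w) , unique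
    where
    unique : ∀ (h : H BG.⇒ X) → proj₁ h ≈ v → (f , u) BG.∘ h BG.≈ (g , w) →
             (v , (u ∘ v) ⁻¹ · w) BG.≈ h
    unique (h , x) h≈v (_ , [uh]·x≈w) = ≈-sym h≈v , (begin
      (u ∘ v) ⁻¹ · w             ≈⟨ ·-resp ≈-refl [uh]·x≈w ⟨
      (u ∘ v) ⁻¹ · ((u ∘ h) · x) ≈⟨ ·-resp ≈-refl (·-resp (∘-resp-≈ ≈-refl h≈v) ≈-refl) ⟩
      (u ∘ v) ⁻¹ · ((u ∘ v) · x) ≈⟨ ·-inverseˡ-cancelˡ (u ∘ v) x ⟩
      x                          ∎)
      where open SetoidReasoning hom-setoid

  ⊤-isGeneric : IsGeneric p ⊤
  ⊤-isGeneric X = (! , ε) , isCartesian (! , ε)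

  isAcyclic⇒rightLifts : ∀ {r} {M : ∀ {J I} → J ⇒ I → Set r} →
                         IsAcyclic p M ⊤ → RightLifts M G
  isAcyclic⇒rightLifts acyclic m m∈M g
    with acyclic (m , ε) (! , g) (isCartesian (m , ε)) (isCartesian (! , g)) m∈M
  ... | (_ , ĝ) , _ , (_ , [ĝm]·ε≈g) = ĝ , ≈-trans (≈-sym (·-unitʳ (ĝ ∘ m))) [ĝm]·ε≈g

  rightLifts⇒isAcyclic : ∀ {r} {M : ∀ {J I} → J ⇒ I → Set r} →
                         RightLifts M G → IsAcyclic p M ⊤
  rightLifts⇒isAcyclic lifts (m , u) (t₁ , t) _ _ m∈M
    with lifts m m∈M (t · u ⁻¹)
  ... | ĝ , ĝm≈t·u⁻¹ =
    (! , ĝ) , isCartesian (! , ĝ) ,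
    (≈-trans (≈-sym (!-unique (! ∘ m))) (!-unique t₁) , (begin
      (ĝ ∘ m) · u     ≈⟨ ·-resp ĝm≈t·u⁻¹ ≈-refl ⟩
      (t · u ⁻¹) · u  ≈⟨ ·-inverseˡ-cancelʳ t u ⟩
      t               ∎))
    where open SetoidReasoning hom-setoid

  isAcyclicGeneric⇔rightLifts : ∀ {r} (M : ∀ {J I} → J ⇒ I → Set r) →
                                IsAcyclicGeneric p M ⊤ ⇔ RightLifts M G
  isAcyclicGeneric⇔rightLifts M = mk⇔ to from
    where
    to : IsAcyclicGeneric p M ⊤ → RightLifts M G
    to (_ , acyclic) = isAcyclic⇒rightLifts acyclic

    from : RightLifts M G → IsAcyclicGeneric p M ⊤
    from lifts = ⊤-isGeneric , rightLifts⇒isAcyclic lifts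

mainTheorem5 : ∀ {o ℓ e r} (B : Category o ℓ e) (L : FiniteLimits B)
                 (M : MonoClass B r) (G : GroupObject B L) →
                 IsAcyclicGeneric (Externalization.p B L G) (MonoClass.member M) (terminalObj L)
                 ⇔ HasRLP B L M (GroupObject.G G)
mainTheorem5 B L M G = isAcyclicGeneric⇔rightLifts (MonoClass.member M)
  where open ExternalizationProperties B L G
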